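{- The class of languages accepted by register set automata is closed under union and intersection, and is not closed under complement (i.e., there is an RsA $\mathcal{A}$ such that no RsA accepts $(\Sigma\times\mathbb{D})^*\setminus L(\mathcal{A})$).
   Context: Fix a finite nonempty alphabet $\Sigma$ and an infinite data domain $\mathbb{D}$. A register set automaton (RsA) is a tuple $(Q,R,\Delta,I,F)$ with $Q$ finite states, $R$ finite registers, $I,F\subseteq Q$, and transitions $q\xrightarrow{a\mid G^{\in},G^{\notin},up}s$ with $a\in\Sigma$, $G^{\in},G^{\notin}\subseteq R$ disjoint, $up\colon R\to 2^{R\cup\{\mathit{in}\}}$. Configurations are $(q,f)$ with $f\colon R\to 2^{\mathbb{D}}$; initial ones have $q\in I$ and all registers empty. A step over $(a,d)$ is possible iff $d\in f(r)$ for all $r\in G^{\in}$ and $d\notin f(r)$ for all $r\in G^{\notin}$; afterwards each register $r$ holds $\bigcup\{f(r')\mid r'\in R\cap up(r)\}$, plus $d$ if $\mathit{in}\in up(r)$. $L(\mathcal{A})\subseteq(\Sigma\times\mathbb{D})^*$ is the set of words with a run from an initial configuration ending in $F$. -}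

module Defs where

open import Level using (0ℓ)
open import Data.Nat using (ℕ)
open import Data.Bool using (Bool; true)
open import Data.Fin using (Fin)
open import Data.Fin.Subset using (Subset; _∈_; _∉_)
open import Data.List using (List; []; _∷_)
open import Data.Product using (Σ; ∃; _×_; _,_)
open import Data.Sum using (_⊎_)
open import Relation.Nullary using (¬_)
open import Relation.Binary.PropositionalEquality using (_≡_)
import Data.List.Membership.Propositional as LM

module RsA (Alph : Set) (D : Set) where

  Word : Set
  Word = List (Alph × D)

  -- The update up : R → 2^(R ∪ {in}) is given by its R-part `upR`
  -- and by the Boolean `upIn` telling whether `in` belongs to up(r).
  record Transition (n m : ℕ) : Set where
    field
      src   : Fin n
      lab   : Alph
      Gin   : Subset m
      Gout  : Subset m
      disj  : ∀ r → r ∈ Gin → r ∉ Gout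
      upR   : Fin m → Subset m
      upIn  : Fin m → Bool
      tgt   : Fin n

  record Automaton : Set where
    field
      states : ℕ
      regs   : ℕ
      Δ      : List (Transition states regs)
      I      : Subset states
      F      : Subset states

  Val : ℕ → Set₁
  Val m = Fin m → D → Set

  emptyVal : ∀ {m} → Val m
  emptyVal _ _ = Data.Empty.⊥
    where import Data.Empty

  module _ {n m : ℕ} (t : Transition n m) where
    open Transition t

    Enabled : Val m → D → Set
    Enabled f d = (∀ r → r ∈ Gin → f r d) × (∀ r → r ∈ Gout → ¬ f r d)

    update : Val m → D → Val m
    update f d r x = (∃ λ r' → r' ∈ upR r × f r' x) ⊎ (upIn r ≡ true × x ≡ d)

  module _ (A : Automaton) where
    open Automaton A

    data AccFrom : Fin states → Val regs → Word → Set₁ where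
      done : ∀ {q f} → q ∈ F → AccFrom q f []
      step : ∀ {q f a d w} (t : Transition states regs) →
             t LM.∈ Δ → Transition.src t ≡ q → Transition.lab t ≡ a →
             Enabled t f d →
             AccFrom (Transition.tgt t) (update t f d) w →
             AccFrom q f ((a , d) ∷ w)

    Accepts : Word → Set₁
    Accepts w = ∃ λ q → q ∈ I × AccFrom q emptyVal w

module Submission where

-- Union and intersection run the two automata side by side (on the sum, respectively the
-- product, of their state sets), each on its own half of a disjoint sum of registers.
--
-- For the complement, `crossing` accepts the data words in which some x y x y occurs as a
-- subsequence of the data. Suppose B accepts exactly the other words, and let N > 2 ^ m where
-- m is the number of registers of B. The word 0 1 … N-1 N-1 … 1 0 has no such subsequence,
-- so B accepts it. After the first half, by pigeonhole two values i < j lie in the same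
-- registers; exchanging i and j in the second half is a renaming of data that fixes B's
-- configuration, so B also accepts the new word, which contains i j i j. Membership of data
-- in registers need not be decidable, but as the goal is a negation the finitely many decisions
-- needed for the pigeonhole may be assumed under double negation.

open import Defs
open import Level using (Level)
open import Data.Bool using (Bool; true; false)
open import Data.Empty using (⊥-elim)
open import Data.Fin as Fin
  using (Fin; zero; suc; toℕ; _↑ˡ_; _↑ʳ_; combine; quotient; remainder; funToFin; finToFun)
open import Data.Fin.Properties
  using ( suc-injective; ↑ˡ-injective; ↑ʳ-injective; splitAt-↑ˡ; splitAt-↑ʳ
        ; combine-injective; combine-remQuot; remQuot-combine
        ; pigeonhole; toℕ<n; finToFun-funToFin )
open import Data.Fin.Subset using (Subset; _∈_; _∉_; ⊥; _∩_; ⁅_⁆)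
open import Data.Fin.Subset.Properties using (∩⇔×; ∉⊥; x∈⁅x⁆; x∈⁅y⁆⇒x≡y)
open import Data.List
  using ( List; []; _∷_; _++_; map; take; drop; filter; allFin; applyUpTo; upTo; downFrom
        ; cartesianProduct; cartesianProductWith )
open import Data.List.Properties using (reverse-upTo; map-++; map-∘)
open import Data.List.Membership.Propositional using () renaming (_∈_ to _∈ₗ_)
open import Data.List.Membership.Propositional.Properties
  using ( ∈-map⁺; ∈-map⁻; ∈-++⁺ˡ; ∈-++⁺ʳ; ∈-++⁻; ∈-filter⁺; ∈-filter⁻
        ; ∈-allFin; ∈-applyUpTo⁺
        ; ∈-cartesianProduct⁺; ∈-cartesianProduct⁻
        ; ∈-cartesianProductWith⁺; ∈-cartesianProductWith⁻ )
open import Data.List.Relation.Binary.Pointwise using (Pointwise; []; _∷_)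
open import Data.List.Relation.Binary.Sublist.Propositional
  using (_⊆_; []; _∷_; _∷ʳ_; from∈; minimum)
open import Data.List.Relation.Binary.Sublist.Propositional.Properties
  using (reverse⁺; All-resp-⊆; ++⁺) renaming (map⁺ to ⊆-map⁺)
open import Data.List.Relation.Unary.All using (_∷_)
open import Data.List.Relation.Unary.AllPairs using (AllPairs; []; _∷_)
import Data.List.Relation.Unary.AllPairs.Properties as AllPairs
open import Data.List.Relation.Unary.Any using (here; there)
open import Data.Nat using (ℕ; zero; suc; _+_; _*_; _<_; _^_; _≟_; s<s⁻¹)
open import Data.Nat.Properties using (n<1+n; <-asym)
open import Data.Product using (∃; ∃₂; _×_; _,_; proj₁; proj₂)
open import Data.Product.Function.NonDependent.Propositional using (_×-⇔_)
open import Data.Sum using (_⊎_; inj₁; inj₂; [_,_]′)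
open import Data.Sum.Function.Propositional using (_⊎-⇔_)
open import Data.Unit using (⊤; tt)
open import Data.Vec using (lookup; tabulate) renaming (_++_ to _++ᵛ_)
open import Data.Vec.Properties
  using (lookup∘tabulate; lookup-++ˡ; lookup-++ʳ; []=⇒lookup; lookup⇒[]=)
open import Data.Vec.Functional using () renaming (_++_ to _++ᶠ_)
open import Function using (_∘_; flip; id)
open import Function.Bundles
  using (_⇔_; mk⇔; Equivalence; _↔_; _↣_; Inverse; Injection)
open import Function.Construct.Composition using (_⇔-∘_)
open import Function.Construct.Identity using (⇔-id)
open import Function.Construct.Symmetry using (⇔-sym)
open import Function.Properties.Inverse using (↔⇒↣)
open import Relation.Binary.Core using (Rel)
open import Relation.Binary.Definitions using (Asymmetric; DecidableEquality)
open import Relation.Binary.PropositionalEquality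
open import Relation.Nullary using (¬_; Dec; yes; no; contradiction)
open import Relation.Nullary.Decidable using (¬¬-excluded-middle; via-injection)
open import Relation.Nullary.Negation using (¬¬-map)

private
  variable
    p : Level
    A : Set p

-- Double negation and a pigeonhole principle for register types

¬¬-∀-Fin : ∀ {n} {P : Fin n → Set p} → (∀ i → ¬ ¬ P i) → ¬ ¬ (∀ i → P i)
¬¬-∀-Fin {n = zero}  _ k = k λ ()
¬¬-∀-Fin {n = suc n} h k =
  h zero λ p₀ → ¬¬-∀-Fin (h ∘ suc) λ ps → k λ { zero → p₀ ; (suc i) → ps i }

bit : {P : Set p} → Dec P → Fin 2
bit (yes _) = suc zero
bit (no _)  = zero

bit-injective : {P Q : Set p} (P? : Dec P) (Q? : Dec Q) → bit P? ≡ bit Q? → P ⇔ Q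
bit-injective (yes p) (yes q) _ = mk⇔ (λ _ → q) (λ _ → p)
bit-injective (no ¬p) (no ¬q) _ = mk⇔ (⊥-elim ∘ ¬p) (⊥-elim ∘ ¬q)

funToFin-injective : ∀ {m n} (f g : Fin m → Fin n) →
                     funToFin f ≡ funToFin g → ∀ i → f i ≡ g i
funToFin-injective f g eq i = begin
  f i                     ≡⟨ finToFun-funToFin f i ⟨
  finToFun (funToFin f) i ≡⟨ cong (λ c → finToFun c i) eq ⟩
  finToFun (funToFin g) i ≡⟨ finToFun-funToFin g i ⟩
  g i                     ∎
  where open ≡-Reasoning

pigeonhole-¬¬ : ∀ m {N} → 2 ^ m < N → (P : ℕ → Fin m → Set p) →
                ¬ ¬ (∃₂ λ i j → i < j × j < N × ∀ r → P i r ⇔ P j r)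
pigeonhole-¬¬ m {N} 2^m<N P = ¬¬-map pick (¬¬-∀-Fin λ _ → ¬¬-∀-Fin λ _ → ¬¬-excluded-middle)
  where
  pick : (∀ (k : Fin N) r → Dec (P (toℕ k) r)) →
         ∃₂ λ i j → i < j × j < N × ∀ r → P i r ⇔ P j r
  pick P? with i , j , i<j , same ← pigeonhole 2^m<N (λ k → funToFin (bit ∘ P? k)) =
    toℕ i , toℕ j , i<j , toℕ<n j ,
    λ r → bit-injective (P? i r) (P? j r) (funToFin-injective _ _ same r)

swap : ℕ → ℕ → ℕ → ℕ
swap i j k with k ≟ i | k ≟ j
... | yes _ | _     = j
... | no _  | yes _ = i
... | no _  | no _  = k

swap-left : ∀ i j → swap i j i ≡ j
swap-left i j with i ≟ i
... | yes _  = refl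
... | no i≢i = contradiction refl i≢i

swap-right : ∀ i j → swap i j j ≡ i
swap-right i j with j ≟ i | j ≟ j
... | yes j≡i | _      = j≡i
... | no _    | yes _  = refl
... | no _    | no j≢j = contradiction refl j≢j

swap-other : ∀ {i j k} → k ≢ i → k ≢ j → swap i j k ≡ k
swap-other {i} {j} {k} k≢i k≢j with k ≟ i | k ≟ j
... | yes k≡i | _       = contradiction k≡i k≢i
... | no _    | yes k≡j = contradiction k≡j k≢j
... | no _    | no _    = refl

swap-involutive : ∀ i j k → swap i j (swap i j k) ≡ k
swap-involutive i j k with k ≟ i | k ≟ j
... | yes refl | _        = swap-right k j
... | no _     | yes refl = swap-left i k
... | no k≢i   | no k≢j   = swap-other k≢i k≢j

swap-injective : ∀ i j {k l} → swap i j k ≡ swap i j l → k ≡ l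
swap-injective i j {k} {l} eq = begin
  k                     ≡⟨ swap-involutive i j k ⟨
  swap i j (swap i j k) ≡⟨ cong (swap i j) eq ⟩
  swap i j (swap i j l) ≡⟨ swap-involutive i j l ⟩
  l                     ∎
  where open ≡-Reasoning

-- Sublists of ascending and descending lists

⊆-++-split : ∀ {xs} (us : List A) {vs} → xs ⊆ us ++ vs →
             ∃ λ k → take k xs ⊆ us × drop k xs ⊆ vs
⊆-++-split []       xs⊆vs = 0 , [] , xs⊆vs
⊆-++-split (u ∷ us) (.u ∷ʳ xs⊆)
  with k , ⊆us , ⊆vs ← ⊆-++-split us xs⊆ = k , u ∷ʳ ⊆us , ⊆vs
⊆-++-split (u ∷ us) (x≡u ∷ xs⊆)
  with k , ⊆us , ⊆vs ← ⊆-++-split us xs⊆ = suc k , x≡u ∷ ⊆us , ⊆vs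

AllPairs-resp-⊆ : ∀ {R : Rel A p} {xs ys} → xs ⊆ ys → AllPairs R ys → AllPairs R xs
AllPairs-resp-⊆ []           []         = []
AllPairs-resp-⊆ (_ ∷ʳ xs⊆)   (_ ∷ Rys)  = AllPairs-resp-⊆ xs⊆ Rys
AllPairs-resp-⊆ (refl ∷ xs⊆) (Ry ∷ Rys) = All-resp-⊆ xs⊆ Ry ∷ AllPairs-resp-⊆ xs⊆ Rys

¬AllPairs-aba : ∀ {R : Rel A p} → Asymmetric R → ∀ {a b zs} → ¬ AllPairs R (a ∷ b ∷ a ∷ zs)
¬AllPairs-aba asym ((aRb ∷ _) ∷ (bRa ∷ _) ∷ _) = asym aRb bRa

abab⊈ascending++descending :
  ∀ {_≺_ : Rel A p} → Asymmetric _≺_ → ∀ {us vs} → AllPairs _≺_ us → AllPairs (flip _≺_) vs →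
  ∀ {a b} → ¬ (a ∷ b ∷ a ∷ b ∷ [] ⊆ us ++ vs)
abab⊈ascending++descending ≺-asym {us} up down abab with ⊆-++-split us abab
... | 0 , _ , ⊆vs = ¬AllPairs-aba (flip ≺-asym) (AllPairs-resp-⊆ ⊆vs down)
... | 1 , _ , ⊆vs = ¬AllPairs-aba (flip ≺-asym) (AllPairs-resp-⊆ ⊆vs down)
... | 2 , ⊆us , ⊆vs
  with (a≺b ∷ _) ∷ _ ← AllPairs-resp-⊆ ⊆us up | (b≺a ∷ _) ∷ _ ← AllPairs-resp-⊆ ⊆vs down
  = ≺-asym a≺b b≺a
... | suc (suc (suc _)) , ⊆us , _ = ¬AllPairs-aba ≺-asym (AllPairs-resp-⊆ ⊆us up)

pair⊆applyUpTo : ∀ (f : ℕ → A) {i j n} → i < j → j < n → f i ∷ f j ∷ [] ⊆ applyUpTo f n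
pair⊆applyUpTo f {zero}  {suc j} {suc n} _ j<n =
  refl ∷ from∈ (∈-applyUpTo⁺ (f ∘ suc) (s<s⁻¹ j<n))
pair⊆applyUpTo f {suc i} {suc j} {suc n} i<j j<n =
  f 0 ∷ʳ pair⊆applyUpTo (f ∘ suc) (s<s⁻¹ i<j) (s<s⁻¹ j<n)

pair⊆downFrom : ∀ {i j n} → i < j → j < n → j ∷ i ∷ [] ⊆ downFrom n
pair⊆downFrom {n = n} i<j j<n =
  subst (_ ⊆_) (reverse-upTo n) (reverse⁺ (pair⊆applyUpTo id i<j j<n))

module _ {m₁ m₂ : ℕ} {P : Subset m₁} {Q : Subset m₂} where

  ↑ˡ-∈-++ : ∀ {r} → r ↑ˡ m₂ ∈ P ++ᵛ Q ⇔ r ∈ P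
  ↑ˡ-∈-++ {r} = mk⇔
    (λ r∈ → lookup⇒[]= r P (trans (sym (lookup-++ˡ P Q r)) ([]=⇒lookup r∈)))
    (λ r∈ → lookup⇒[]= (r ↑ˡ m₂) (P ++ᵛ Q) (trans (lookup-++ˡ P Q r) ([]=⇒lookup r∈)))

  ↑ʳ-∈-++ : ∀ {r} → m₁ ↑ʳ r ∈ P ++ᵛ Q ⇔ r ∈ Q
  ↑ʳ-∈-++ {r} = mk⇔
    (λ r∈ → lookup⇒[]= r Q (trans (sym (lookup-++ʳ P Q r)) ([]=⇒lookup r∈)))
    (λ r∈ → lookup⇒[]= (m₁ ↑ʳ r) (P ++ᵛ Q) (trans (lookup-++ʳ P Q r) ([]=⇒lookup r∈)))

↑ˡ≢↑ʳ : ∀ {m₁ m₂} (i : Fin m₁) (j : Fin m₂) → i ↑ˡ m₂ ≢ m₁ ↑ʳ j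
↑ˡ≢↑ʳ zero    j ()
↑ˡ≢↑ʳ (suc i) j eq = ↑ˡ≢↑ʳ i j (suc-injective eq)

data Split (m₁ m₂ : ℕ) : Fin (m₁ + m₂) → Set where
  inl : ∀ r → Split m₁ m₂ (r ↑ˡ m₂)
  inr : ∀ r → Split m₁ m₂ (m₁ ↑ʳ r)

split : ∀ m₁ {m₂} r → Split m₁ m₂ r
split zero          r       = inr r
split (suc m₁)      zero    = inl zero
split (suc m₁) {m₂} (suc r) with split m₁ {m₂} r
... | inl r′ = inl (suc r′)
... | inr r′ = inr r′

module _ {m₁ m₂ : ℕ} where

  split-∀ : ∀ {P : Fin (m₁ + m₂) → Set p} →
            (∀ r → P (r ↑ˡ m₂)) → (∀ r → P (m₁ ↑ʳ r)) → ∀ r → P r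
  split-∀ Pˡ Pʳ r with split m₁ r
  ... | inl r′ = Pˡ r′
  ... | inr r′ = Pʳ r′

  split-∃ : ∀ {P : Fin (m₁ + m₂) → Set p} →
            ∃ P → ∃ (λ r → P (r ↑ˡ m₂)) ⊎ ∃ (λ r → P (m₁ ↑ʳ r))
  split-∃ (r , Pr) with split m₁ r
  ... | inl r′ = inj₁ (r′ , Pr)
  ... | inr r′ = inj₂ (r′ , Pr)

preimage : ∀ {n m} → (Fin n → Fin m) → Subset m → Subset n
preimage h P = tabulate (lookup P ∘ h)

∈-preimage : ∀ {n m} {h : Fin n → Fin m} {P x} → x ∈ preimage h P ⇔ h x ∈ P
∈-preimage {h = h} {P} {x} = mk⇔
  (λ x∈ → lookup⇒[]= (h x) P (trans (sym (lookup∘tabulate _ x)) ([]=⇒lookup x∈)))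
  (λ hx∈ → lookup⇒[]= x (preimage h P) (trans (lookup∘tabulate _ x) ([]=⇒lookup hx∈)))

_⊗_ : ∀ {n₁ n₂} → Subset n₁ → Subset n₂ → Subset (n₁ * n₂)
_⊗_ {n₁} {n₂} P Q = preimage (quotient {n₁} n₂) P ∩ preimage (remainder {n₁} n₂) Q

combine-∈-⊗ : ∀ {n₁ n₂} {P : Subset n₁} {Q : Subset n₂} {q₁ q₂} →
              combine q₁ q₂ ∈ P ⊗ Q ⇔ (q₁ ∈ P × q₂ ∈ Q)
combine-∈-⊗ {n₁} {n₂} {P} {Q} {q₁} {q₂} =
  subst (λ (a , b) → combine q₁ q₂ ∈ P ⊗ Q ⇔ (a ∈ P × b ∈ Q)) (remQuot-combine q₁ q₂)
        ((∈-preimage {h = quotient {n₁} n₂} ×-⇔ ∈-preimage {h = remainder {n₁} n₂})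
         ⇔-∘ ∩⇔×)

data Paired {n₁ n₂ : ℕ} : Fin (n₁ * n₂) → Set where
  paired : (q₁ : Fin n₁) (q₂ : Fin n₂) → Paired (combine q₁ q₂)

unpair : ∀ n₁ n₂ (q : Fin (n₁ * n₂)) → Paired {n₁} {n₂} q
unpair n₁ n₂ q = subst (Paired {n₁} {n₂}) (combine-remQuot {n₁} n₂ q) (paired _ _)

module Automata (Alph D : Set) where
  open RsA Alph D
  open Equivalence

  -- The register part of a transition: `Enabled t` and `update t` unfold to
  -- `Permits (action t)` and `perform (action t)`.
  record Action (m : ℕ) : Set where
    field
      Gin  : Subset m
      Gout : Subset m
      disj : ∀ r → r ∈ Gin → r ∉ Gout
      upR  : Fin m → Subset m
      upIn : Fin m → Bool

  open Action

  action : ∀ {n m} → Transition n m → Action m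
  action t = record { Transition t }

  arc : ∀ {n m} → Fin n → Alph → Action m → Fin n → Transition n m
  arc s a α s′ = record { src = s ; lab = a ; tgt = s′ ; Action α }

  Permits : ∀ {m} → Action m → Val m → D → Set
  Permits α f d = (∀ r → r ∈ Gin α → f r d) × (∀ r → r ∈ Gout α → ¬ f r d)

  perform : ∀ {m} → Action m → Val m → D → Val m
  perform α f d r x = (∃ λ r′ → r′ ∈ upR α r × f r′ x) ⊎ (upIn α r ≡ true × x ≡ d)

  idle : ∀ {m} → Action m
  idle = record
    { Gin = ⊥ ; Gout = ⊥ ; disj = λ _ _ → ∉⊥ ; upR = λ _ → ⊥ ; upIn = λ _ → false }

  permits-idle : ∀ {m} (f : Val m) {d} → Permits idle f d
  permits-idle _ = (λ _ r∈⊥ → ⊥-elim (∉⊥ r∈⊥)) , (λ _ r∈⊥ → ⊥-elim (∉⊥ r∈⊥))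

  perform-kept : ∀ {m} (α : Action m) r {f d x} →
                 upR α r ≡ ⁅ r ⁆ → upIn α r ≡ false → perform α f d r x ⇔ f r x
  perform-kept α r {f} {x = x} upR≡ upIn≡ rewrite upR≡ | upIn≡ = mk⇔
    (λ { (inj₁ (r′ , r′∈ , fx)) → subst (λ r′ → f r′ x) (x∈⁅y⁆⇒x≡y r r′∈) fx
       ; (inj₂ (() , _)) })
    (λ fx → inj₁ (r , x∈⁅x⁆ r , fx))

  perform-stored : ∀ {m} (α : Action m) r {f d x} →
                   upR α r ≡ ⊥ → upIn α r ≡ true → perform α f d r x ⇔ (x ≡ d)
  perform-stored α _ upR≡ upIn≡ rewrite upR≡ | upIn≡ = mk⇔
    (λ { (inj₁ (_ , r′∈⊥ , _)) → ⊥-elim (∉⊥ r′∈⊥) ; (inj₂ (_ , x≡d)) → x≡d })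
    (λ x≡d → inj₂ (refl , x≡d))

  _≐_ : ∀ {m} → Val m → Val m → Set
  f ≐ g = ∀ r x → f r x ⇔ g r x

  ≐-refl : ∀ {m} (f : Val m) → f ≐ f
  ≐-refl _ _ _ = ⇔-id _

  module RegisterSum (m₁ m₂ : ℕ) where

    left : Val (m₁ + m₂) → Val m₁
    left g r = g (r ↑ˡ m₂)

    right : Val (m₁ + m₂) → Val m₂
    right g r = g (m₁ ↑ʳ r)

    _⊕_ : Action m₁ → Action m₂ → Action (m₁ + m₂)
    α₁ ⊕ α₂ = record
      { Gin  = Gin α₁ ++ᵛ Gin α₂
      ; Gout = Gout α₁ ++ᵛ Gout α₂
      ; disj = split-∀ (λ r i o → disj α₁ r (to ↑ˡ-∈-++ i) (to ↑ˡ-∈-++ o))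
                       (λ r i o → disj α₂ r (to ↑ʳ-∈-++ i) (to ↑ʳ-∈-++ o))
      ; upR  = (λ r → upR α₁ r ++ᵛ ⊥) ++ᶠ (λ r → ⊥ ++ᵛ upR α₂ r)
      ; upIn = upIn α₁ ++ᶠ upIn α₂
      }

    module _ (α₁ : Action m₁) (α₂ : Action m₂)
             {g : Val (m₁ + m₂)} {f₁ : Val m₁} {f₂ : Val m₂} {d : D}
             (g≐ˡ : left g ≐ f₁) (g≐ʳ : right g ≐ f₂) where

      permits-⊕ : Permits (α₁ ⊕ α₂) g d ⇔ (Permits α₁ f₁ d × Permits α₂ f₂ d)
      permits-⊕ = mk⇔
        (λ (ins , outs) →
          ( (λ r r∈ → to (g≐ˡ r d) (ins _ (from ↑ˡ-∈-++ r∈)))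
          , (λ r r∈ f₁rd → outs _ (from ↑ˡ-∈-++ r∈) (from (g≐ˡ r d) f₁rd)) )
        , ( (λ r r∈ → to (g≐ʳ r d) (ins _ (from ↑ʳ-∈-++ r∈)))
          , (λ r r∈ f₂rd → outs _ (from ↑ʳ-∈-++ r∈) (from (g≐ʳ r d) f₂rd)) ))
        (λ ((ins₁ , outs₁) , (ins₂ , outs₂)) →
          split-∀ (λ r r∈ → from (g≐ˡ r d) (ins₁ r (to ↑ˡ-∈-++ r∈)))
                  (λ r r∈ → from (g≐ʳ r d) (ins₂ r (to ↑ʳ-∈-++ r∈)))
        , split-∀ (λ r r∈ grd → outs₁ r (to ↑ˡ-∈-++ r∈) (to (g≐ˡ r d) grd))
                  (λ r r∈ grd → outs₂ r (to ↑ʳ-∈-++ r∈) (to (g≐ʳ r d) grd)))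

    module _ (α₁ : Action m₁) (α₂ : Action m₂) {g : Val (m₁ + m₂)} {d : D} where

      perform-⊕ˡ : ∀ {f₁} → left g ≐ f₁ →
                   left (perform (α₁ ⊕ α₂) g d) ≐ perform α₁ f₁ d
      perform-⊕ˡ {f₁} g≐ˡ r x rewrite splitAt-↑ˡ m₁ r m₂ = from-left ⊎-⇔ ⇔-id _
        where
        from-left : (∃ λ r′ → r′ ∈ upR α₁ r ++ᵛ ⊥ × g r′ x) ⇔
                    (∃ λ r′ → r′ ∈ upR α₁ r × f₁ r′ x)
        from-left = mk⇔
          (λ ∃r → [ (λ (r′ , r′∈ , gx) → r′ , to ↑ˡ-∈-++ r′∈ , to (g≐ˡ r′ x) gx)
                  , (λ (_ , r′∈ , _) → ⊥-elim (∉⊥ (to (↑ʳ-∈-++ {P = upR α₁ r}) r′∈)))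
                  ]′ (split-∃ ∃r))
          (λ (r′ , r′∈ , fx) → r′ ↑ˡ m₂ , from ↑ˡ-∈-++ r′∈ , from (g≐ˡ r′ x) fx)

      perform-⊕ʳ : ∀ {f₂} → right g ≐ f₂ →
                   right (perform (α₁ ⊕ α₂) g d) ≐ perform α₂ f₂ d
      perform-⊕ʳ {f₂} g≐ʳ r x rewrite splitAt-↑ʳ m₁ m₂ r = from-right ⊎-⇔ ⇔-id _
        where
        from-right : (∃ λ r′ → r′ ∈ ⊥ ++ᵛ upR α₂ r × g r′ x) ⇔
                     (∃ λ r′ → r′ ∈ upR α₂ r × f₂ r′ x)
        from-right = mk⇔
          (λ ∃r → [ (λ (_ , r′∈ , _) →
                      ⊥-elim (∉⊥ (to (↑ˡ-∈-++ {Q = upR α₂ r}) r′∈)))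
                  , (λ (r′ , r′∈ , gx) → r′ , to ↑ʳ-∈-++ r′∈ , to (g≐ʳ r′ x) gx)
                  ]′ (split-∃ ∃r))
          (λ (r′ , r′∈ , fx) → m₁ ↑ʳ r′ , from ↑ʳ-∈-++ r′∈ , from (g≐ʳ r′ x) fx)

  module Union (A B : Automaton) where
    open Automaton A using () renaming (states to n₁; regs to m₁; Δ to Δ₁; I to I₁; F to F₁)
    open Automaton B using () renaming (states to n₂; regs to m₂; Δ to Δ₂; I to I₂; F to F₂)
    open Transition
    open RegisterSum m₁ m₂

    embedˡ : Transition n₁ m₁ → Transition (n₁ + n₂) (m₁ + m₂)
    embedˡ t = arc (src t ↑ˡ n₂) (lab t) (action t ⊕ idle) (tgt t ↑ˡ n₂)

    embedʳ : Transition n₂ m₂ → Transition (n₁ + n₂) (m₁ + m₂)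
    embedʳ t = arc (n₁ ↑ʳ src t) (lab t) (idle ⊕ action t) (n₁ ↑ʳ tgt t)

    A∪B : Automaton
    A∪B = record
      { states = n₁ + n₂ ; regs = m₁ + m₂
      ; Δ = map embedˡ Δ₁ ++ map embedʳ Δ₂ ; I = I₁ ++ᵛ I₂ ; F = F₁ ++ᵛ F₂ }

    embedˡ-accepts : ∀ {q f g w} → AccFrom A q f w → left g ≐ f → AccFrom A∪B (q ↑ˡ n₂) g w
    embedˡ-accepts (done q∈F) _ = done (from ↑ˡ-∈-++ q∈F)
    embedˡ-accepts {g = g} (step t t∈Δ refl refl en acc) g≐f =
      step (embedˡ t) (∈-++⁺ˡ (∈-map⁺ embedˡ t∈Δ)) refl refl
        (from (permits-⊕ (action t) idle g≐f (≐-refl (right g))) (en , permits-idle (right g)))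
        (embedˡ-accepts acc (perform-⊕ˡ (action t) idle g≐f))

    embedʳ-accepts : ∀ {q f g w} → AccFrom B q f w → right g ≐ f → AccFrom A∪B (n₁ ↑ʳ q) g w
    embedʳ-accepts (done q∈F) _ = done (from (↑ʳ-∈-++ {P = F₁}) q∈F)
    embedʳ-accepts {g = g} (step t t∈Δ refl refl en acc) g≐f =
      step (embedʳ t) (∈-++⁺ʳ (map embedˡ Δ₁) (∈-map⁺ embedʳ t∈Δ)) refl refl
        (from (permits-⊕ idle (action t) (≐-refl (left g)) g≐f) (permits-idle (left g) , en))
        (embedʳ-accepts acc (perform-⊕ʳ idle (action t) g≐f))

    projectˡ-accepts : ∀ {q g f w} → AccFrom A∪B (q ↑ˡ n₂) g w → left g ≐ f → AccFrom A q f w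
    projectˡ-accepts (done q∈F) _ = done (to ↑ˡ-∈-++ q∈F)
    projectˡ-accepts {g = g} (step t t∈Δ src≡ refl en acc) g≐f
      with ∈-++⁻ (map embedˡ Δ₁) t∈Δ
    ... | inj₁ t∈ with t₁ , t₁∈Δ₁ , refl ← ∈-map⁻ embedˡ t∈ =
      step t₁ t₁∈Δ₁ (↑ˡ-injective n₂ _ _ src≡) refl
        (proj₁ (to (permits-⊕ (action t₁) idle g≐f (≐-refl (right g))) en))
        (projectˡ-accepts acc (perform-⊕ˡ (action t₁) idle g≐f))
    ... | inj₂ t∈ with _ , _ , refl ← ∈-map⁻ embedʳ t∈ =
      contradiction (sym src≡) (↑ˡ≢↑ʳ _ _)

    projectʳ-accepts : ∀ {q g f w} → AccFrom A∪B (n₁ ↑ʳ q) g w → right g ≐ f → AccFrom B q f w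
    projectʳ-accepts (done q∈F) _ = done (to (↑ʳ-∈-++ {P = F₁}) q∈F)
    projectʳ-accepts {g = g} (step t t∈Δ src≡ refl en acc) g≐f
      with ∈-++⁻ (map embedˡ Δ₁) t∈Δ
    ... | inj₁ t∈ with _ , _ , refl ← ∈-map⁻ embedˡ t∈ =
      contradiction src≡ (↑ˡ≢↑ʳ _ _)
    ... | inj₂ t∈ with t₂ , t₂∈Δ₂ , refl ← ∈-map⁻ embedʳ t∈ =
      step t₂ t₂∈Δ₂ (↑ʳ-injective n₁ _ _ src≡) refl
        (proj₂ (to (permits-⊕ idle (action t₂) (≐-refl (left g)) g≐f) en))
        (projectʳ-accepts acc (perform-⊕ʳ idle (action t₂) g≐f))

    accepts-∪ : ∀ w → Accepts A∪B w ⇔ (Accepts A w ⊎ Accepts B w)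
    accepts-∪ w = mk⇔ project embed
      where
      embed : Accepts A w ⊎ Accepts B w → Accepts A∪B w
      embed (inj₁ (q , q∈I , acc)) =
        q ↑ˡ n₂ , from ↑ˡ-∈-++ q∈I , embedˡ-accepts acc (≐-refl emptyVal)
      embed (inj₂ (q , q∈I , acc)) =
        n₁ ↑ʳ q , from (↑ʳ-∈-++ {P = I₁}) q∈I , embedʳ-accepts acc (≐-refl emptyVal)

      project : Accepts A∪B w → Accepts A w ⊎ Accepts B w
      project (q , q∈I , acc) with split n₁ q
      ... | inl q₁ = inj₁ (q₁ , to ↑ˡ-∈-++ q∈I , projectˡ-accepts acc (≐-refl emptyVal))
      ... | inr q₂ =
        inj₂ (q₂ , to (↑ʳ-∈-++ {P = I₁}) q∈I , projectʳ-accepts acc (≐-refl emptyVal))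

  module Intersection (_≟ₐ_ : DecidableEquality Alph) (A B : Automaton) where
    open Automaton A using () renaming (states to n₁; regs to m₁; Δ to Δ₁; I to I₁; F to F₁)
    open Automaton B using () renaming (states to n₂; regs to m₂; Δ to Δ₂; I to I₂; F to F₂)
    open Transition
    open RegisterSum m₁ m₂

    synchronise : Transition n₁ m₁ × Transition n₂ m₂ → Transition (n₁ * n₂) (m₁ + m₂)
    synchronise (t₁ , t₂) = arc (combine (src t₁) (src t₂)) (lab t₁)
                                (action t₁ ⊕ action t₂) (combine (tgt t₁) (tgt t₂))

    sameLabel? : (tt : Transition n₁ m₁ × Transition n₂ m₂) →
                 Dec (lab (proj₁ tt) ≡ lab (proj₂ tt))
    sameLabel? (t₁ , t₂) = lab t₁ ≟ₐ lab t₂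

    A∩B : Automaton
    A∩B = record
      { states = n₁ * n₂ ; regs = m₁ + m₂
      ; Δ = map synchronise (filter sameLabel? (cartesianProduct Δ₁ Δ₂))
      ; I = I₁ ⊗ I₂ ; F = F₁ ⊗ F₂ }

    synchronise-∈ : ∀ {t₁ t₂} → t₁ ∈ₗ Δ₁ → t₂ ∈ₗ Δ₂ → lab t₁ ≡ lab t₂ →
                    synchronise (t₁ , t₂) ∈ₗ Automaton.Δ A∩B
    synchronise-∈ t₁∈ t₂∈ same =
      ∈-map⁺ synchronise (∈-filter⁺ sameLabel? (∈-cartesianProduct⁺ t₁∈ t₂∈) same)

    ∈-synchronised : ∀ {t} → t ∈ₗ Automaton.Δ A∩B →
                     ∃₂ λ t₁ t₂ → t₁ ∈ₗ Δ₁ × t₂ ∈ₗ Δ₂ × lab t₁ ≡ lab t₂ ×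
                                  t ≡ synchronise (t₁ , t₂)
    ∈-synchronised t∈ with (t₁ , t₂) , tt∈ , refl ← ∈-map⁻ synchronise t∈
                        with tt∈Δ₁×Δ₂ , same ← ∈-filter⁻ sameLabel? tt∈ =
      let t₁∈ , t₂∈ = ∈-cartesianProduct⁻ Δ₁ Δ₂ tt∈Δ₁×Δ₂
      in t₁ , t₂ , t₁∈ , t₂∈ , same , refl

    product-accepts : ∀ {q₁ q₂ f₁ f₂ g w} → AccFrom A q₁ f₁ w → AccFrom B q₂ f₂ w →
                      left g ≐ f₁ → right g ≐ f₂ → AccFrom A∩B (combine q₁ q₂) g w
    product-accepts (done q₁∈F) (done q₂∈F) _ _ = done (from combine-∈-⊗ (q₁∈F , q₂∈F))
    product-accepts (step t₁ t₁∈ refl refl en₁ acc₁) (step t₂ t₂∈ refl same en₂ acc₂)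
                    g≐ˡ g≐ʳ =
      step (synchronise (t₁ , t₂)) (synchronise-∈ t₁∈ t₂∈ (sym same)) refl refl
        (from (permits-⊕ (action t₁) (action t₂) g≐ˡ g≐ʳ) (en₁ , en₂))
        (product-accepts acc₁ acc₂ (perform-⊕ˡ (action t₁) (action t₂) g≐ˡ)
                                   (perform-⊕ʳ (action t₁) (action t₂) g≐ʳ))

    components-accept : ∀ {q₁ q₂ f₁ f₂ g w} → AccFrom A∩B (combine q₁ q₂) g w →
                        left g ≐ f₁ → right g ≐ f₂ → AccFrom A q₁ f₁ w × AccFrom B q₂ f₂ w
    components-accept (done q∈F) _ _ =
      let q₁∈F , q₂∈F = to combine-∈-⊗ q∈F in done q₁∈F , done q₂∈F
    components-accept (step t t∈Δ src≡ refl en acc) g≐ˡ g≐ʳ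
      with t₁ , t₂ , t₁∈ , t₂∈ , same , refl ← ∈-synchronised t∈Δ =
      let src₁≡ , src₂≡ = combine-injective _ _ _ _ src≡
          en₁ , en₂ = to (permits-⊕ (action t₁) (action t₂) g≐ˡ g≐ʳ) en
          acc₁ , acc₂ = components-accept acc (perform-⊕ˡ (action t₁) (action t₂) g≐ˡ)
                                              (perform-⊕ʳ (action t₁) (action t₂) g≐ʳ)
      in step t₁ t₁∈ src₁≡ refl en₁ acc₁ , step t₂ t₂∈ src₂≡ (sym same) en₂ acc₂

    accepts-∩ : ∀ w → Accepts A∩B w ⇔ (Accepts A w × Accepts B w)
    accepts-∩ w = mk⇔ project product
      where
      product : Accepts A w × Accepts B w → Accepts A∩B w
      product ((q₁ , q₁∈I , acc₁) , (q₂ , q₂∈I , acc₂)) =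
        combine q₁ q₂ , from combine-∈-⊗ (q₁∈I , q₂∈I) ,
        product-accepts acc₁ acc₂ (≐-refl emptyVal) (≐-refl emptyVal)

      project : Accepts A∩B w → Accepts A w × Accepts B w
      project (q , q∈I , acc) with unpair n₁ n₂ q
      ... | paired q₁ q₂ =
        let q₁∈I , q₂∈I = to combine-∈-⊗ q∈I
            acc₁ , acc₂ = components-accept acc (≐-refl emptyVal) (≐-refl emptyVal)
        in (q₁ , q₁∈I , acc₁) , (q₂ , q₂∈I , acc₂)

  -- Splitting runs and renaming data

  AccFrom-++⁻ : ∀ A u {q f v} → AccFrom A q f (u ++ v) → ∃₂ λ q′ f′ →
                AccFrom A q′ f′ v × (∀ {v′} → AccFrom A q′ f′ v′ → AccFrom A q f (u ++ v′))
  AccFrom-++⁻ A []      acc = _ , _ , acc , λ acc′ → acc′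
  AccFrom-++⁻ A (_ ∷ u) (step t t∈Δ src≡ lab≡ en acc)
    with q′ , f′ , rest , resume ← AccFrom-++⁻ A u acc =
    q′ , f′ , rest , λ acc′ → step t t∈Δ src≡ lab≡ en (resume acc′)

  record PartialBijection (ρ : D → D → Set) : Set where
    field
      functional : ∀ {x y y′} → ρ x y → ρ x y′ → y ≡ y′
      injective  : ∀ {x x′ y} → ρ x y → ρ x′ y → x ≡ x′

  Related : ∀ {m} → (D → D → Set) → Val m → Val m → Set
  Related ρ f g = ∀ r {x y} → ρ x y → f r x ⇔ g r y

  Renaming : (D → D → Set) → Alph × D → Alph × D → Set
  Renaming ρ (a , d) (b , e) = a ≡ b × ρ d e

  module _ {ρ : D → D → Set} (ρ-bijective : PartialBijection ρ) where
    open PartialBijection ρ-bijective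

    permits-rename : ∀ {m} (α : Action m) {f g d e} → Related ρ f g → ρ d e →
                     Permits α f d → Permits α g e
    permits-rename α f~g d~e (ins , outs) =
      (λ r r∈ → to (f~g r d~e) (ins r r∈)) ,
      (λ r r∈ gre → outs r r∈ (from (f~g r d~e) gre))

    perform-rename : ∀ {m} (α : Action m) {f g d e} → Related ρ f g → ρ d e →
                     Related ρ (perform α f d) (perform α g e)
    perform-rename α f~g d~e r x~y = mk⇔
      (λ { (inj₁ (r′ , r′∈ , fx)) → inj₁ (r′ , r′∈ , to (f~g r′ x~y) fx)
         ; (inj₂ (stores , refl)) → inj₂ (stores , functional x~y d~e) })
      (λ { (inj₁ (r′ , r′∈ , gy)) → inj₁ (r′ , r′∈ , from (f~g r′ x~y) gy)
         ; (inj₂ (stores , refl)) → inj₂ (stores , injective x~y d~e) })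

    accepts-rename : ∀ A {q f g w w′} → Related ρ f g → Pointwise (Renaming ρ) w w′ →
                     AccFrom A q f w → AccFrom A q g w′
    accepts-rename A f~g [] (done q∈F) = done q∈F
    accepts-rename A f~g ((refl , d~e) ∷ w~w′) (step t t∈Δ src≡ lab≡ en acc) =
      step t t∈Δ src≡ lab≡ (permits-rename (action t) f~g d~e en)
        (accepts-rename A (perform-rename (action t) f~g d~e) w~w′ acc)

  module Crossing (letters : List Alph) (letters-complete : ∀ a → a ∈ₗ letters) where

    pattern q₀ = zero
    pattern q₁ = suc q₀
    pattern q₂ = suc q₁
    pattern q₃ = suc q₂
    pattern q₄ = suc q₃

    pattern X = zero
    pattern Y = suc zero

    data Move : Set where
      stay : Fin 5 → Move
      storeX storeY matchX matchY : Move

    moves : List Move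
    moves = storeX ∷ storeY ∷ matchX ∷ matchY ∷ map stay (allFin 5)

    move∈moves : ∀ μ → μ ∈ₗ moves
    move∈moves storeX   = here refl
    move∈moves storeY   = there (here refl)
    move∈moves matchX   = there (there (here refl))
    move∈moves matchY   = there (there (there (here refl)))
    move∈moves (stay q) = there (there (there (there (∈-map⁺ stay (∈-allFin q)))))

    source target : Move → Fin 5
    source (stay q) = q
    source storeX   = q₀
    source storeY   = q₁
    source matchX   = q₂
    source matchY   = q₃
    target (stay q) = q
    target storeX   = q₁
    target storeY   = q₂
    target matchX   = q₃
    target matchY   = q₄

    guard : Move → Subset 2
    guard matchX = ⁅ X ⁆
    guard matchY = ⁅ Y ⁆
    guard _      = ⊥

    -- storeX loads the datum into both registers; Y is reloaded by storeY before it is read.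
    keeps : Move → Fin 2 → Subset 2
    keeps storeX _ = ⊥
    keeps storeY X = ⁅ X ⁆
    keeps storeY Y = ⊥
    keeps _      r = ⁅ r ⁆

    loads : Move → Fin 2 → Bool
    loads storeX _ = true
    loads storeY X = false
    loads storeY Y = true
    loads _      _ = false

    act : Move → Action 2
    act μ = record
      { Gin = guard μ ; Gout = ⊥ ; disj = λ _ _ → ∉⊥ ; upR = keeps μ ; upIn = loads μ }

    transition : Alph → Move → Transition 5 2
    transition a μ = arc (source μ) a (act μ) (target μ)

    crossing : Automaton
    crossing = record
      { states = 5 ; regs = 2 ; Δ = cartesianProductWith transition letters moves
      ; I = ⁅ q₀ ⁆ ; F = ⁅ q₄ ⁆ }

    Alternating : List D → Set
    Alternating ds = ∃₂ λ x y → x ∷ y ∷ x ∷ y ∷ [] ⊆ ds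

    -- Acceptance from state q with valuation f, in terms of the remaining data ds.
    Pending : Fin 5 → Val 2 → List D → Set
    Pending q₀ f ds = Alternating ds
    Pending q₁ f ds = ∃₂ λ x y → f X x × y ∷ x ∷ y ∷ [] ⊆ ds
    Pending q₂ f ds = ∃₂ λ x y → f X x × f Y y × x ∷ y ∷ [] ⊆ ds
    Pending q₃ f ds = ∃ λ y → f Y y × y ∷ [] ⊆ ds
    Pending q₄ f ds = ⊤

    pending-mono : ∀ q {f g ds} → (∀ r {x} → f r x → g r x) → Pending q f ds → Pending q g ds
    pending-mono q₀ f⊆g p                     = p
    pending-mono q₁ f⊆g (x , y , Xx , s)      = x , y , f⊆g X Xx , s
    pending-mono q₂ f⊆g (x , y , Xx , Yy , s) = x , y , f⊆g X Xx , f⊆g Y Yy , s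
    pending-mono q₃ f⊆g (y , Yy , s)          = y , f⊆g Y Yy , s
    pending-mono q₄ f⊆g _                     = tt

    pending-stay : ∀ q {f d ds} → Pending q f ds ⇔ Pending q (perform (act (stay q)) f d) ds
    pending-stay q {f} = mk⇔ (pending-mono q λ r → from (kept r)) (pending-mono q λ r → to (kept r))
      where kept = λ r {x} → perform-kept (act (stay q)) r {f} {x = x} refl refl

    pending-skip : ∀ q {f d ds} → Pending q f ds → Pending q f (d ∷ ds)
    pending-skip q₀ (x , y , s)           = x , y , _ ∷ʳ s
    pending-skip q₁ (x , y , Xx , s)      = x , y , Xx , _ ∷ʳ s
    pending-skip q₂ (x , y , Xx , Yy , s) = x , y , Xx , Yy , _ ∷ʳ s
    pending-skip q₃ (y , Yy , s)          = y , Yy , _ ∷ʳ s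
    pending-skip q₄ _                     = tt

    pending-step : ∀ μ {f d ds} → Permits (act μ) f d →
                   Pending (target μ) (perform (act μ) f d) ds → Pending (source μ) f (d ∷ ds)
    pending-step (stay q) _ p = pending-skip q (from (pending-stay q) p)
    pending-step storeX {f} _ (x , y , Xx , s) =
      x , y , to (perform-stored (act storeX) X {f} refl refl) Xx ∷ s
    pending-step storeY {f} _ (x , y , Xx , Yy , s) =
      x , y , to (perform-kept (act storeY) X {f} refl refl) Xx ,
      to (perform-stored (act storeY) Y {f} refl refl) Yy ∷ s
    pending-step matchX {f} (ins , _) (y , Yy , s) =
      _ , y , ins X (x∈⁅x⁆ X) , to (perform-kept (act matchX) Y {f} refl refl) Yy , refl ∷ s
    pending-step matchY (ins , _) _ = _ , ins Y (x∈⁅x⁆ Y) , refl ∷ minimum _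

    accepts⇒pending : ∀ {q f w} → AccFrom crossing q f w → Pending q f (map proj₂ w)
    accepts⇒pending (done q∈F) with refl ← x∈⁅y⁆⇒x≡y q₄ q∈F = tt
    accepts⇒pending (step t t∈Δ refl refl en acc)
      with _ , μ , _ , _ , refl ← ∈-cartesianProductWith⁻ transition letters moves t∈Δ =
      pending-step μ en (accepts⇒pending acc)

    unguarded : ∀ {P : Fin 2 → Set} r → r ∈ ⊥ → P r
    unguarded _ r∈⊥ = ⊥-elim (∉⊥ r∈⊥)

    guarded-by : ∀ {f : Val 2} {r d} → f r d → ∀ r′ → r′ ∈ ⁅ r ⁆ → f r′ d
    guarded-by {f} {d = d} frd r′ r′∈ = subst (λ r → f r d) (sym (x∈⁅y⁆⇒x≡y _ r′∈)) frd

    move-step : ∀ μ {a f d w} → (∀ r → r ∈ guard μ → f r d) →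
                AccFrom crossing (target μ) (perform (act μ) f d) w →
                AccFrom crossing (source μ) f ((a , d) ∷ w)
    move-step μ {a} ins acc = step (transition a μ)
      (∈-cartesianProductWith⁺ transition (letters-complete a) (move∈moves μ)) refl refl
      (ins , unguarded) acc

    stay-step : ∀ q {a f d w} → AccFrom crossing q (perform (act (stay q)) f d) w →
                AccFrom crossing q f ((a , d) ∷ w)
    stay-step q = move-step (stay q) unguarded

    pending⇒accepts : ∀ q {f} w → Pending q f (map proj₂ w) → AccFrom crossing q f w
    pending⇒accepts q₀ (_ ∷ w) (x , y , _ ∷ʳ s) =
      stay-step q₀ (pending⇒accepts q₀ w (x , y , s))
    pending⇒accepts q₀ {f} (_ ∷ w) (x , y , refl ∷ s) =
      move-step storeX unguarded (pending⇒accepts q₁ w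
        (x , y , from (perform-stored (act storeX) X {f} refl refl) refl , s))
    pending⇒accepts q₁ (_ ∷ w) (x , y , Xx , _ ∷ʳ s) =
      stay-step q₁ (pending⇒accepts q₁ w (to (pending-stay q₁) (x , y , Xx , s)))
    pending⇒accepts q₁ {f} (_ ∷ w) (x , y , Xx , refl ∷ s) =
      move-step storeY unguarded (pending⇒accepts q₂ w
        (x , y , from (perform-kept (act storeY) X {f} refl refl) Xx ,
         from (perform-stored (act storeY) Y {f} refl refl) refl , s))
    pending⇒accepts q₂ (_ ∷ w) (x , y , Xx , Yy , _ ∷ʳ s) =
      stay-step q₂ (pending⇒accepts q₂ w (to (pending-stay q₂) (x , y , Xx , Yy , s)))
    pending⇒accepts q₂ {f} (_ ∷ w) (x , y , Xx , Yy , refl ∷ s) =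
      move-step matchX (guarded-by {f} Xx) (pending⇒accepts q₃ w
        (y , from (perform-kept (act matchX) Y {f} refl refl) Yy , s))
    pending⇒accepts q₃ (_ ∷ w) (y , Yy , _ ∷ʳ s) =
      stay-step q₃ (pending⇒accepts q₃ w (to (pending-stay q₃) (y , Yy , s)))
    pending⇒accepts q₃ {f} (_ ∷ w) (y , Yy , refl ∷ _) =
      move-step matchY (guarded-by {f} Yy) (pending⇒accepts q₄ w tt)
    pending⇒accepts q₄ []      _ = done (x∈⁅x⁆ q₄)
    pending⇒accepts q₄ (_ ∷ w) _ = stay-step q₄ (pending⇒accepts q₄ w tt)

    accepts-crossing : ∀ w → Accepts crossing w ⇔ Alternating (map proj₂ w)
    accepts-crossing w = mk⇔
      (λ (q , q∈I , acc) →
        subst (λ q → Pending q _ _) (x∈⁅y⁆⇒x≡y q₀ q∈I) (accepts⇒pending acc))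
      (λ alt → q₀ , x∈⁅x⁆ q₀ , pending⇒accepts q₀ w alt)

  module NonComplementable (letters : List Alph) (letters-complete : ∀ a → a ∈ₗ letters)
                           (a₀ : Alph) (δ : ℕ → D)
                           (δ-injective : ∀ {i j} → δ i ≡ δ j → i ≡ j) where
    open Crossing letters letters-complete

    encode : List ℕ → Word
    encode = map (λ k → a₀ , δ k)

    map-proj₂-encode : ∀ ns → map proj₂ (encode ns) ≡ map δ ns
    map-proj₂-encode ns = sym (map-∘ ns)

    _≺_ : D → D → Set
    x ≺ y = ∃₂ λ i j → x ≡ δ i × y ≡ δ j × i < j

    ≺-asym : Asymmetric _≺_
    ≺-asym (i , j , refl , refl , i<j) (_ , _ , δj≡ , δi≡ , j<i)
      with refl ← δ-injective δj≡ | refl ← δ-injective δi≡ = <-asym i<j j<i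

    up-down-not-alternating : ∀ N → ¬ Alternating (map δ (upTo N ++ downFrom N))
    up-down-not-alternating N (_ , _ , abab) =
      abab⊈ascending++descending ≺-asym
        (AllPairs.map⁺ {R = _≺_} {f = δ}
          (AllPairs.applyUpTo⁺₁ id N λ {i} {j} i<j _ → i , j , refl , refl , i<j))
        (AllPairs.map⁺ {R = flip _≺_} {f = δ}
          (AllPairs.applyDownFrom⁺₁ id N λ {i} {j} j<i _ → j , i , refl , refl , j<i))
        (subst (_ ⊆_) (map-++ δ (upTo N) (downFrom N)) abab)

    swapped-alternating : ∀ {i j N} → i < j → j < N →
                          Alternating (map δ (upTo N ++ map (swap i j) (downFrom N)))
    swapped-alternating {i} {j} {N} i<j j<N =
      δ i , δ j , ⊆-map⁺ δ (++⁺ (pair⊆applyUpTo id i<j j<N) i∷j⊆swapped)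
      where
      i∷j⊆swapped : i ∷ j ∷ [] ⊆ map (swap i j) (downFrom N)
      i∷j⊆swapped = subst₂ (λ a b → a ∷ b ∷ [] ⊆ map (swap i j) (downFrom N))
                           (swap-right i j) (swap-left i j)
                           (⊆-map⁺ (swap i j) (pair⊆downFrom i<j j<N))

    Swapped : ℕ → ℕ → D → D → Set
    Swapped i j x y = ∃ λ k → x ≡ δ k × y ≡ δ (swap i j k)

    swapped-bijective : ∀ i j → PartialBijection (Swapped i j)
    swapped-bijective i j = record
      { functional = λ { (_ , refl , refl) (_ , δk≡ , refl) →
                           cong (δ ∘ swap i j) (δ-injective δk≡) }
      ; injective  = λ { (_ , refl , refl) (_ , refl , δk≡) →
                           cong δ (swap-injective i j (δ-injective δk≡)) }
      }

    related-swapped : ∀ {m} {f : Val m} {i j} →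
                      (∀ r → f r (δ i) ⇔ f r (δ j)) → Related (Swapped i j) f f
    related-swapped {i = i} {j} same r (k , refl , refl) with k ≟ i | k ≟ j
    ... | yes refl | _        = same r
    ... | no _     | yes refl = ⇔-sym (same r)
    ... | no _     | no _     = ⇔-id _

    encode-swapped : ∀ {i j} ns →
                     Pointwise (Renaming (Swapped i j)) (encode ns) (encode (map (swap i j) ns))
    encode-swapped []       = []
    encode-swapped (k ∷ ns) = (refl , k , refl , refl) ∷ encode-swapped ns

    crossing-rejects-up-down : ∀ N → ¬ Accepts crossing (encode (upTo N ++ downFrom N))
    crossing-rejects-up-down N acc = up-down-not-alternating N
      (subst Alternating (map-proj₂-encode _) (to (accepts-crossing _) acc))

    crossing-accepts-swapped : ∀ {i j N} → i < j → j < N →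
                               Accepts crossing (encode (upTo N ++ map (swap i j) (downFrom N)))
    crossing-accepts-swapped i<j j<N = from (accepts-crossing _)
      (subst Alternating (sym (map-proj₂-encode _)) (swapped-alternating i<j j<N))

    ¬¬-accepts-swapped : ∀ B {N} → 2 ^ Automaton.regs B < N →
                         Accepts B (encode (upTo N ++ downFrom N)) →
                         ¬ ¬ ∃₂ λ i j → i < j × j < N ×
                               Accepts B (encode (upTo N ++ map (swap i j) (downFrom N)))
    ¬¬-accepts-swapped B {N} 2^regs<N (q , q∈I , acc)
      with _ , f , suffix , resume ← AccFrom-++⁻ B (encode (upTo N))
             (subst (AccFrom B q emptyVal) (map-++ _ (upTo N) _) acc)
      = ¬¬-map swap-suffix (pigeonhole-¬¬ (Automaton.regs B) 2^regs<N λ k r → f r (δ k))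
      where
      swap-suffix : ∃₂ (λ i j → i < j × j < N × ∀ r → f r (δ i) ⇔ f r (δ j)) →
                    ∃₂ λ i j → i < j × j < N ×
                      Accepts B (encode (upTo N ++ map (swap i j) (downFrom N)))
      swap-suffix (i , j , i<j , j<N , same) =
        i , j , i<j , j<N , q , q∈I , subst (AccFrom B q emptyVal) (sym (map-++ _ (upTo N) _))
          (resume (accepts-rename (swapped-bijective i j) B (related-swapped same)
                                  (encode-swapped (downFrom N)) suffix))

    not-complementable : ¬ ∃ λ B → ∀ w → Accepts B w ⇔ (¬ Accepts crossing w)
    not-complementable (B , B⇔∁) =
      ¬¬-accepts-swapped B (n<1+n _) (from (B⇔∁ _) (crossing-rejects-up-down N))
        λ (_ , _ , i<j , j<N , acc) → to (B⇔∁ _) acc (crossing-accepts-swapped i<j j<N)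
      where
      N : ℕ
      N = suc (2 ^ Automaton.regs B)

theorem4p3 : (Alph : Set) (k : ℕ) → (Alph ↔ Fin (suc k)) →
    (D : Set) → (ℕ ↣ D) →
    let open RsA Alph D in
    (∀ (A B : Automaton) → ∃ λ (C : Automaton) →
       ∀ w → Accepts C w ⇔ (Accepts A w ⊎ Accepts B w))
    × (∀ (A B : Automaton) → ∃ λ (C : Automaton) →
       ∀ w → Accepts C w ⇔ (Accepts A w × Accepts B w))
    × (∃ λ (A : Automaton) → ¬ (∃ λ (B : Automaton) →
       ∀ w → Accepts B w ⇔ (¬ Accepts A w)))
theorem4p3 Alph k Alph↔Fin D ℕ↣D =
  (λ A B → A∪B A B , accepts-∪ A B) ,
  (λ A B → A∩B A B , accepts-∩ A B) ,
  (crossing , not-complementable)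
  where
  open Automata Alph D
  open Inverse Alph↔Fin using ()
    renaming (to to index; from to letter; strictlyInverseʳ to letter∘index)

  letters : List Alph
  letters = map letter (allFin (suc k))

  letters-complete : ∀ a → a ∈ₗ letters
  letters-complete a = subst (_∈ₗ letters) (letter∘index a) (∈-map⁺ letter (∈-allFin (index a)))

  open Union using (A∪B; accepts-∪)
  open Intersection (via-injection (↔⇒↣ Alph↔Fin) Fin._≟_) using (A∩B; accepts-∩)
  open Crossing letters letters-complete using (crossing)
  open NonComplementable letters letters-complete (letter zero)
         (Injection.to ℕ↣D) (Injection.injective ℕ↣D) using (not-complementable)
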